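{- There is a constant $C>0$ such that for every integer $n\ge 1$ and every $k\in\mathbb{Z}/n\mathbb{Z}$, if $S$ is a subset of $\mathbb{Z}/n\mathbb{Z}$ chosen uniformly at random among all $2^n$ subsets, then \[ \mathbb{P}(k\notin S+S)\le C\,(3/4)^{n/2}, \] i.e. $\mathbb{P}(k\notin S+S)=O\big((3/4)^{n/2}\big)$.
   Context: For $S\subseteq \mathbb{Z}/n\mathbb{Z}$, $S+S=\{x+y: x,y\in S\}$ (sums taken modulo $n$). -}

module Defs where

open import Data.Nat using (ℕ; zero; suc; _+_; NonZero)
open import Data.Nat.DivMod using (_%_)
open import Data.Fin using (Fin; toℕ)
open import Data.Fin.Subset using (Subset; _∈_; inside; outside)
open import Data.Fin.Subset.Properties using (_∈?_)
open import Data.Fin.Properties using (any?)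
open import Data.List using (List; []; _∷_; _++_; map; filter; length)
open import Data.Vec using ([]; _∷_)
open import Data.Product using (∃; ∃₂; _×_; _,_)
open import Data.Product.Properties using ()
open import Relation.Nullary using (Dec; ¬_; _×-dec_; ¬?)
open import Relation.Binary.PropositionalEquality using (_≡_)
import Data.Nat.Properties as ℕP

-- Addition in ℤ/nℤ, with ℤ/nℤ represented by Fin n = {0,…,n-1}.
-- The value is returned as a natural number in [0,n).
addMod : (n : ℕ) .{{_ : NonZero n}} → Fin n → Fin n → ℕ
addMod n x y = (toℕ x + toℕ y) % n

_∈S+S_ : {n : ℕ} .{{_ : NonZero n}} → Fin n → Subset n → Set
_∈S+S_ {n} k S = ∃₂ λ x y → x ∈ S × y ∈ S × addMod n x y ≡ toℕ k

_∈S+S?_ : {n : ℕ} .{{_ : NonZero n}} (k : Fin n) (S : Subset n) → Dec (k ∈S+S S)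
_∈S+S?_ {n} k S =
  any? λ x → any? λ y → (x ∈? S) ×-dec ((y ∈? S) ×-dec (addMod n x y ℕP.≟ toℕ k))

allSubsets : (n : ℕ) → List (Subset n)
allSubsets zero = [] ∷ []
allSubsets (suc n) = map (inside ∷_) (allSubsets n) ++ map (outside ∷_) (allSubsets n)

-- Number of subsets S ⊆ ℤ/nℤ with k ∉ S + S.
-- P(k ∉ S+S) for uniform S equals  missCount n k / 2^n.
missCount : (n : ℕ) .{{_ : NonZero n}} → Fin n → ℕ
missCount n k = length (filter (λ S → ¬? (k ∈S+S? S)) (allSubsets n))

{-# OPTIONS --safe #-}
-- Let r be the involution x ↦ k − x of ℤ/nℤ. If k ∉ S + S then S contains no fixed point of r
-- and at most one element of each two-point orbit {x, r x}, so its trace on an orbit is one of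
-- three patterns. Given two such sets S and T, write the pattern of S at the smaller element of
-- each orbit and that of T at the larger one: this encodes the pair (S , T) injectively as a word
-- in {0,1,2}ⁿ. Hence missCount n k ² ≤ 3ⁿ, which is the claim with C = 1.
module Submission where

open import Defs
open import Data.Bool using (Bool; true; false; _∧_)
open import Data.Bool.Properties using (∧-idem)
open import Data.Empty using (⊥-elim)
open import Data.Fin as Fin using (Fin; zero; suc; toℕ; fromℕ<; combine; remQuot; funToFin; finToFun)
open import Data.Fin.Properties
  using (toℕ-injective; toℕ<n; toℕ-fromℕ<; <-cmp; combine-remQuot; finToFun-funToFin; injective⇒≤)
open import Data.Fin.Subset using (Subset; inside; outside)
open import Data.List as List using (List; []; _∷_; length; map)
open import Data.List.Membership.Propositional using (_∈_)
open import Data.List.Membership.Propositional.Properties using (∈-map⁻; ∈-lookup)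
open import Data.List.Relation.Unary.All as All using (All; [])
open import Data.List.Relation.Unary.All.Properties using (all-filter)
open import Data.List.Relation.Unary.AllPairs using ([]; _∷_)
open import Data.List.Relation.Unary.Unique.Propositional using (Unique)
import Data.List.Relation.Unary.Unique.Propositional.Properties as Unique
open import Data.Nat as ℕ using (ℕ; _+_; _*_; _∸_; _^_; _≤_; NonZero)
open import Data.Nat.DivMod using (_%_; %-distribˡ-+; m%n%n≡m%n; [m+n]%n≡m%n; m<n⇒m%n≡m; m%n<n)
open import Data.Nat.Properties using (+-assoc; +-comm; m+[n∸m]≡n; m∸n+n≡m; <⇒≤; *-identityˡ; *-identityʳ)
open import Data.Product using (∃; _×_; _,_; proj₁; proj₂; uncurry)
open import Data.Vec using (Vec; _∷_; lookup)
open import Data.Vec.Properties using (lookup⇒[]=; ∷-injectiveʳ; tabulate∘lookup; tabulate-cong)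
open import Relation.Binary.Definitions using (tri<; tri≈; tri>)
open import Relation.Binary.PropositionalEquality
open import Relation.Nullary using (¬_; ¬?)
open import Function using (_∘_)

[m+n%d]%d≡[m+n]%d : ∀ m n d .{{_ : NonZero d}} → (m + n % d) % d ≡ (m + n) % d
[m+n%d]%d≡[m+n]%d m n d = begin
  (m + n % d) % d             ≡⟨ %-distribˡ-+ m (n % d) d ⟩
  (m % d + n % d % d) % d     ≡⟨ cong (λ z → (m % d + z) % d) (m%n%n≡m%n n d) ⟩
  (m % d + n % d) % d         ≡⟨ %-distribˡ-+ m n d ⟨
  (m + n) % d                 ∎
  where open ≡-Reasoning

m+n≡d⇒[m+[n+a]%d]%d≡a%d : ∀ {m n d} .{{_ : NonZero d}} a → m + n ≡ d → (m + (n + a) % d) % d ≡ a % d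
m+n≡d⇒[m+[n+a]%d]%d≡a%d {m} {n} {d} a m+n≡d = begin
  (m + (n + a) % d) % d   ≡⟨ [m+n%d]%d≡[m+n]%d m (n + a) d ⟩
  (m + (n + a)) % d       ≡⟨ cong (_% d) (+-assoc m n a) ⟨
  (m + n + a) % d         ≡⟨ cong (λ z → (z + a) % d) m+n≡d ⟩
  (d + a) % d             ≡⟨ cong (_% d) (+-comm d a) ⟩
  (a + d) % d             ≡⟨ [m+n]%n≡m%n a d ⟩
  a % d                   ∎
  where open ≡-Reasoning

funToFin-injective : ∀ {m n} {f g : Fin m → Fin n} → funToFin f ≡ funToFin g → ∀ x → f x ≡ g x
funToFin-injective {f = f} {g} e x =
  trans (sym (finToFun-funToFin f x)) (trans (cong (λ c → finToFun c x) e) (finToFun-funToFin g x))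

remQuot-injective : ∀ {m} n {i j : Fin (m * n)} → remQuot {m} n i ≡ remQuot n j → i ≡ j
remQuot-injective {m} n {i} {j} e =
  trans (sym (combine-remQuot {m} n i)) (trans (cong (uncurry combine) e) (combine-remQuot {m} n j))

lookup-extensional : ∀ {A : Set} {m} {u v : Vec A m} → (∀ i → lookup u i ≡ lookup v i) → u ≡ v
lookup-extensional {u = u} {v} u≗v = trans (sym (tabulate∘lookup u)) (trans (tabulate-cong u≗v) (tabulate∘lookup v))

module _ {A : Set} where

  lookup-injective : ∀ {xs : List A} → Unique xs → ∀ {i j} → List.lookup xs i ≡ List.lookup xs j → i ≡ j
  lookup-injective (_ ∷ _)         {zero}  {zero}  _ = refl
  lookup-injective {_ ∷ xs} (x∉xs ∷ _) {zero}  {suc j} e = ⊥-elim (All.lookup x∉xs (∈-lookup {xs = xs} j) e)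
  lookup-injective {_ ∷ xs} (x∉xs ∷ _) {suc i} {zero}  e = ⊥-elim (All.lookup x∉xs (∈-lookup {xs = xs} i) (sym e))
  lookup-injective (_ ∷ xs-unique) {suc i} {suc j} e = cong suc (lookup-injective xs-unique e)

length*length≤ : ∀ {A B : Set} {xs : List A} {ys : List B} {m} → Unique xs → Unique ys →
                 (f : A → B → Fin m) →
                 (∀ {a a′ b b′} → a ∈ xs → a′ ∈ xs → b ∈ ys → b′ ∈ ys → f a b ≡ f a′ b′ → a ≡ a′ × b ≡ b′) →
                 length xs * length ys ≤ m
length*length≤ {xs = xs} {ys} {m} xs-unique ys-unique f f-injective = injective⇒≤ g-injective
  where
  g : Fin (length xs * length ys) → Fin m
  g i = uncurry (λ a b → f (List.lookup xs a) (List.lookup ys b)) (remQuot {length xs} (length ys) i)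

  g-injective : ∀ {i j} → g i ≡ g j → i ≡ j
  g-injective e =
    let a≡a′ , b≡b′ = f-injective (∈-lookup _) (∈-lookup _) (∈-lookup _) (∈-lookup _) e
    in remQuot-injective {length xs} (length ys)
         (cong₂ _,_ (lookup-injective xs-unique a≡a′) (lookup-injective ys-unique b≡b′))

module Reflection {n} .{{_ : NonZero n}} (k : Fin n) where

  -- x ↦ k − x, computed as (n − x + k) mod n to avoid truncated subtraction
  reflect : Fin n → Fin n
  reflect x = fromℕ< (m%n<n (n ∸ toℕ x + toℕ k) n)

  addMod-comm : ∀ x y → addMod n x y ≡ addMod n y x
  addMod-comm x y = cong (_% n) (+-comm (toℕ x) (toℕ y))

  addMod-reflect : ∀ x → addMod n x (reflect x) ≡ toℕ k
  addMod-reflect x = begin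
    (toℕ x + toℕ (reflect x)) % n               ≡⟨ cong (λ z → (toℕ x + z) % n) (toℕ-fromℕ< _) ⟩
    (toℕ x + (n ∸ toℕ x + toℕ k) % n) % n       ≡⟨ m+n≡d⇒[m+[n+a]%d]%d≡a%d (toℕ k) (m+[n∸m]≡n (<⇒≤ (toℕ<n x))) ⟩
    toℕ k % n                                   ≡⟨ m<n⇒m%n≡m (toℕ<n k) ⟩
    toℕ k                                       ∎
    where open ≡-Reasoning

  addMod≡⇒≡reflect : ∀ {x y} → addMod n x y ≡ toℕ k → y ≡ reflect x
  addMod≡⇒≡reflect {x} {y} x+y≡k = toℕ-injective (begin
    toℕ y                                       ≡⟨ m<n⇒m%n≡m (toℕ<n y) ⟨
    toℕ y % n                                   ≡⟨ m+n≡d⇒[m+[n+a]%d]%d≡a%d (toℕ y) (m∸n+n≡m (<⇒≤ (toℕ<n x))) ⟨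
    (n ∸ toℕ x + (toℕ x + toℕ y) % n) % n       ≡⟨ cong (λ z → (n ∸ toℕ x + z) % n) x+y≡k ⟩
    (n ∸ toℕ x + toℕ k) % n                     ≡⟨ toℕ-fromℕ< _ ⟨
    toℕ (reflect x)                             ∎)
    where open ≡-Reasoning

  reflect-involutive : ∀ x → reflect (reflect x) ≡ x
  reflect-involutive x = sym (addMod≡⇒≡reflect (trans (addMod-comm (reflect x) x) (addMod-reflect x)))

  ∉S+S⇒independent : ∀ {S} → ¬ (k ∈S+S S) → ∀ x → lookup S x ∧ lookup S (reflect x) ≡ false
  ∉S+S⇒independent {S} k∉S+S x with lookup S x in Sx | lookup S (reflect x) in Srx
  ... | false | _     = refl
  ... | true  | false = refl
  ... | true  | true  =
    ⊥-elim (k∉S+S (x , reflect x , lookup⇒[]= x S Sx , lookup⇒[]= (reflect x) S Srx , addMod-reflect x))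

code : Bool → Bool → Fin 3
code false false = zero
code true  _     = suc zero
code false true  = suc (suc zero)

uncode : Fin 3 → Bool × Bool
uncode zero             = false , false
uncode (suc zero)       = true , false
uncode (suc (suc zero)) = false , true

uncode-code : ∀ {a b} → a ∧ b ≡ false → uncode (code a b) ≡ (a , b)
uncode-code {false} {false} _ = refl
uncode-code {false} {true}  _ = refl
uncode-code {true}  {false} _ = refl

module PairEncoding {n} (r : Fin n → Fin n) (r-involutive : ∀ x → r (r x) ≡ x) where

  Independent : Subset n → Set
  Independent S = ∀ x → lookup S x ∧ lookup S (r x) ≡ false

  encode : Subset n → Subset n → Fin n → Fin 3
  encode S T x with <-cmp x (r x)
  ... | tri< _ _ _ = code (lookup S x) (lookup S (r x))
  ... | tri≈ _ _ _ = zero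
  ... | tri> _ _ _ = code (lookup T (r x)) (lookup T x)

  decodeAt : Fin n → Fin 3 → Fin 3 → Bool × Bool
  decodeAt x c c′ with <-cmp x (r x)
  ... | tri< _ _ _ = proj₁ (uncode c) , proj₁ (uncode c′)
  ... | tri≈ _ _ _ = false , false
  ... | tri> _ _ _ = proj₂ (uncode c′) , proj₂ (uncode c)

  decode : (Fin n → Fin 3) → Fin n → Bool × Bool
  decode c x = decodeAt x (c x) (c (r x))

  module _ {S T} (S-indep : Independent S) (T-indep : Independent T) where

    uncode-encode-lower : ∀ {x} → x Fin.< r x → uncode (encode S T x) ≡ (lookup S x , lookup S (r x))
    uncode-encode-lower {x} x<rx with <-cmp x (r x)
    ... | tri< _ _ _    = uncode-code (S-indep x)
    ... | tri≈ x≮rx _ _ = ⊥-elim (x≮rx x<rx)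
    ... | tri> x≮rx _ _ = ⊥-elim (x≮rx x<rx)

    uncode-encode-upper : ∀ {x} → x Fin.< r x → uncode (encode S T (r x)) ≡ (lookup T x , lookup T (r x))
    uncode-encode-upper {x} x<rx with <-cmp (r x) (r (r x)) | r-involutive x
    ... | tri> _ _ _     | rrx≡x rewrite rrx≡x = uncode-code (T-indep x)
    ... | tri< _ _ rx≯x  | rrx≡x rewrite rrx≡x = ⊥-elim (rx≯x x<rx)
    ... | tri≈ _ _ rx≯x  | rrx≡x rewrite rrx≡x = ⊥-elim (rx≯x x<rx)


    decode-encode : ∀ x → decode (encode S T) x ≡ (lookup S x , lookup T x)
    decode-encode x with <-cmp x (r x)
    ... | tri< x<rx _ _ =
      cong₂ _,_ (cong proj₁ (uncode-code (S-indep x))) (cong proj₁ (uncode-encode-upper x<rx))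
    ... | tri≈ _ x≡rx _ = cong₂ _,_ (absent-at-fixed-point S S-indep) (absent-at-fixed-point T T-indep)
      where
      absent-at-fixed-point : ∀ U → Independent U → false ≡ lookup U x
      absent-at-fixed-point U U-indep = trans
        (sym (subst (λ y → lookup U x ∧ lookup U y ≡ false) (sym x≡rx) (U-indep x)))
        (∧-idem (lookup U x))
    ... | tri> _ _ rx<x = cong₂ _,_
      (trans (cong proj₂ (uncode-encode-lower rx<rrx)) (cong (lookup S) (r-involutive x)))
      (cong proj₂ (uncode-code T-indep-at-rx))
      where
      T-indep-at-rx : lookup T (r x) ∧ lookup T x ≡ false
      T-indep-at-rx = subst (λ y → lookup T (r x) ∧ lookup T y ≡ false) (r-involutive x) (T-indep (r x))

      rx<rrx : r x Fin.< r (r x)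
      rx<rrx = subst (r x Fin.<_) (sym (r-involutive x)) rx<x

  encode-injective : ∀ {S T S′ T′} → Independent S → Independent T → Independent S′ → Independent T′ →
                     (∀ x → encode S T x ≡ encode S′ T′ x) → S ≡ S′ × T ≡ T′
  encode-injective {S} {T} {S′} {T′} S-indep T-indep S′-indep T′-indep e =
    lookup-extensional (cong proj₁ ∘ agree) , lookup-extensional (cong proj₂ ∘ agree)
    where
    agree : ∀ x → (lookup S x , lookup T x) ≡ (lookup S′ x , lookup T′ x)
    agree x = begin
      (lookup S x , lookup T x)     ≡⟨ decode-encode S-indep T-indep x ⟨
      decode (encode S T) x         ≡⟨ cong₂ (decodeAt x) (e x) (e (r x)) ⟩
      decode (encode S′ T′) x       ≡⟨ decode-encode S′-indep T′-indep x ⟩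
      (lookup S′ x , lookup T′ x)   ∎
      where open ≡-Reasoning

  independent-length²≤3^n : ∀ {Ss} → Unique Ss → All Independent Ss → length Ss * length Ss ≤ 3 ^ n
  independent-length²≤3^n Ss-unique Ss-indep =
    length*length≤ Ss-unique Ss-unique (λ S T → funToFin (encode S T))
      λ S∈ S′∈ T∈ T′∈ e → encode-injective (indep S∈) (indep T∈) (indep S′∈) (indep T′∈) (funToFin-injective e)
    where
    indep = All.lookup Ss-indep

allSubsets-unique : ∀ n → Unique (allSubsets n)
allSubsets-unique ℕ.zero    = [] ∷ []
allSubsets-unique (ℕ.suc n) = Unique.++⁺ (Unique.map⁺ ∷-injectiveʳ (allSubsets-unique n))
                                         (Unique.map⁺ ∷-injectiveʳ (allSubsets-unique n))
                                         heads-differ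
  where
  heads-differ : ∀ {S} → ¬ (S ∈ map (inside ∷_) (allSubsets n) × S ∈ map (outside ∷_) (allSubsets n))
  heads-differ (S∈ins , S∈outs) with ∈-map⁻ (inside ∷_) S∈ins | ∈-map⁻ (outside ∷_) S∈outs
  ... | _ , _ , refl | _ , _ , ()

missCount²≤3^n : ∀ n .{{_ : NonZero n}} (k : Fin n) → missCount n k * missCount n k ≤ 3 ^ n
missCount²≤3^n n k = independent-length²≤3^n
  (Unique.filter⁺ (λ S → ¬? (k ∈S+S? S)) (allSubsets-unique n))
  (All.map ∉S+S⇒independent (all-filter (λ S → ¬? (k ∈S+S? S)) (allSubsets n)))
  where
  open Reflection k
  open PairEncoding reflect reflect-involutive

lemma2 : ∃ λ (C : ℕ) → NonZero C ×
           ((n : ℕ) .{{_ : NonZero n}} → (k : Fin n) →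
             missCount n k ^ 2 ≤ (C ^ 2) * (3 ^ n))
lemma2 = 1 , _ , λ n k →
  subst₂ _≤_ (cong (missCount n k *_) (sym (*-identityʳ _))) (sym (*-identityˡ _)) (missCount²≤3^n n k)
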